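{- Let $m\in\mathbb N$, $L\in\mathcal{CS}_m$, $L_0,\dots,L_{m-1}\in\mathcal H$ with $L=L_0+\cdots+L_{m-1}$, and let $f:L\hookrightarrow L$ be an order-embedding. Then $f[B]\subseteq B$ for every $B\in\mathrm{Block}(L)$.
   Context: $X\hookrightarrow Y$ means $X$ order-embeds into $Y$. $\sum_\omega L_i=L_0+L_1+\cdots$ and $\sum_{\omega^*}L_i=\cdots+L_1+L_0$. A sequence $\langle L_i:i\in\omega\rangle$ satisfies $(*)$ if for each $i$ the set $\{j:L_i\hookrightarrow L_j\}$ is infinite. $\mathcal H$ is the smallest class of order types of countable linear orders containing the one-element type and containing $\sum_\omega L_i$ and $\sum_{\omega^*}L_i$ for every sequence in $\mathcal H$ satisfying $(*)$. An $\omega$-sum (resp. $\omega^*$-sum) is an order $\sum_\omega L_i$ (resp. $\sum_{\omega^*}L_i$) for such a sequence. $\mathcal{CS}$ is the class of countable scattered linear orders, $m(L)$ the least $n$ such that $L$ is a sum of $n$ elements of $\mathcal H$, $\mathcal{CS}_m=\{L\in\mathcal{CS}:m(L)=m\}$. Given the decomposition $L=L_0+\cdots+L_{m-1}$, a block is a sum $B=L_i+\cdots+L_{i+k}$ of consecutive summands, $k\ge0$, satisfying one of: (A) $|L_j|=1$ for all $j\in\{i,\dots,i+k\}$, and ($i=0$ or $L_{i-1}$ is infinite) and ($i+k=m-1$ or $L_{i+k+1}$ is infinite); (B) $L_j$ is an $\omega$-sum for all $j\in\{i,\dots,i+k\}$, and ($i=0$ or ($L_{i-1}$ is an $\omega$-sum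 and $L_{i-2}$ is an $\omega^*$-sum)) and ($i+k=m-1$ or $L_{i+k+1}$ is not an $\omega$-sum); (C) $L_j$ is an $\omega^*$-sum for all $j\in\{i,\dots,i+k\}$, and ($i=0$ or $L_{i-1}$ is not an $\omega^*$-sum) and ($i+k=m-1$ or ($L_{i+k+1}$ is an $\omega^*$-sum and $L_{i+k+2}$ is an $\omega$-sum)); (D) $k=1$, $L_i$ is an $\omega^*$-sum and $L_{i+1}$ is an $\omega$-sum. $\mathrm{Block}(L)$ denotes the set of blocks. -}

module Defs where

open import Data.Nat using (ℕ; zero; suc; _+_; _≤_; _<_)
open import Data.Fin using (Fin; toℕ; fromℕ<)
import Data.Fin as F
open import Data.Rational using (ℚ)
import Data.Rational as Q
open import Data.Unit using (⊤; tt)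
open import Data.Empty using (⊥)
open import Data.Product using (Σ; ∃; _×_; _,_; proj₁; proj₂)
open import Data.Sum using (_⊎_)
open import Function.Bundles using (_↔_)
open import Relation.Nullary using (¬_)
open import Relation.Binary.PropositionalEquality using (_≡_)

-- No laws are required: every order in 𝓗, and every finite sum of
-- such, is isomorphic to one built from the constructions below,
-- all of which are strict linear orders.

record Ord : Set₁ where
  field
    Carrier : Set
    _≺_     : Carrier → Carrier → Set
open Ord public

Embedding : Ord → Ord → Set
Embedding X Y =
  Σ (Carrier X → Carrier Y) λ f →
    ∀ x y → _≺_ X x y → _≺_ Y (f x) (f y)

_↪_ : Ord → Ord → Set
X ↪ Y = Embedding X Y

record _≅_ (X Y : Ord) : Set where
  field
    to       : Carrier X → Carrier Y
    from     : Carrier Y → Carrier X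
    from-to  : ∀ x → from (to x) ≡ x
    to-from  : ∀ y → to (from y) ≡ y
    to-mono  : ∀ x x' → _≺_ X x x' → _≺_ Y (to x) (to x')
    from-mono : ∀ y y' → _≺_ Y y y' → _≺_ X (from y) (from y')

𝟙 : Ord
𝟙 = record { Carrier = ⊤ ; _≺_ = λ _ _ → ⊥ }

data LexLt {I : Set} (_<I_ : I → I → Set) (C : I → Ord)
     : Σ I (λ i → Carrier (C i)) → Σ I (λ i → Carrier (C i)) → Set where
  inter : ∀ {i j x y} → i <I j → LexLt _<I_ C (i , x) (j , y)
  intra : ∀ {i x y} → _≺_ (C i) x y → LexLt _<I_ C (i , x) (i , y)

IndexedSum : {I : Set} → (I → I → Set) → (I → Ord) → Ord
IndexedSum {I} _<I_ C = record
  { Carrier = Σ I (λ i → Carrier (C i))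
  ; _≺_ = LexLt _<I_ C }

ωSum : (ℕ → Ord) → Ord
ωSum = IndexedSum _<_

ω*Sum : (ℕ → Ord) → Ord
ω*Sum = IndexedSum (λ i j → j < i)

FinSum : {m : ℕ} → (Fin m → Ord) → Ord
FinSum = IndexedSum F._<_

-- condition (*): for each i, {j : L_i ↪ L_j} is infinite
Star : (ℕ → Ord) → Set
Star Ls = ∀ i n → ∃ λ j → n ≤ j × (Ls i ↪ Ls j)

-- the class 𝓗 (closed under isomorphism: it is a class of order types)
data IsH : Ord → Set₁ where
  one  : (L : Ord) → L ≅ 𝟙 → IsH L
  ωs   : (L : Ord) (Ls : ℕ → Ord) → (∀ i → IsH (Ls i)) → Star Ls →
         L ≅ ωSum Ls → IsH L
  ω*s  : (L : Ord) (Ls : ℕ → Ord) → (∀ i → IsH (Ls i)) → Star Ls →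
         L ≅ ω*Sum Ls → IsH L

IsωSum : Ord → Set₁
IsωSum L = Σ (ℕ → Ord) λ Ls → (∀ i → IsH (Ls i)) × Star Ls × (L ≅ ωSum Ls)

Isω*Sum : Ord → Set₁
Isω*Sum L = Σ (ℕ → Ord) λ Ls → (∀ i → IsH (Ls i)) × Star Ls × (L ≅ ω*Sum Ls)

Countable : Ord → Set
Countable L = Σ (Carrier L → ℕ) λ e → ∀ x y → e x ≡ e y → x ≡ y

ℚOrd : Ord
ℚOrd = record { Carrier = ℚ ; _≺_ = Q._<_ }

Scattered : Ord → Set
Scattered L = ¬ (ℚOrd ↪ L)

SumOfH : ℕ → Ord → Set₁
SumOfH n L = Σ (Fin n → Ord) λ K → (∀ i → IsH (K i)) × (L ≅ FinSum K)

InCS : ℕ → Ord → Set₁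
InCS m L = Countable L × Scattered L × SumOfH m L ×
           (∀ n → n < m → ¬ SumOfH n L)

-- Blocks of a decomposition L_0 + ⋯ + L_{m-1}
-- Predicates at natural-number positions; a position outside
-- {0,…,m-1} satisfies none of them.

module _ {m : ℕ} (Ls : Fin m → Ord) where

  SingletonAt : ℕ → Set
  SingletonAt j = Σ (j < m) λ p →
    Σ (Carrier (Ls (fromℕ< p))) λ x → ∀ y → y ≡ x

  InfiniteAt : ℕ → Set
  InfiniteAt j = Σ (j < m) λ p →
    ¬ (Σ ℕ λ n → Carrier (Ls (fromℕ< p)) ↔ Fin n)

  ωAt : ℕ → Set₁
  ωAt j = Σ (j < m) λ p → IsωSum (Ls (fromℕ< p))

  ω*At : ℕ → Set₁
  ω*At j = Σ (j < m) λ p → Isω*Sum (Ls (fromℕ< p))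

  AllIn : ∀ {ℓ} → ℕ → ℕ → (ℕ → Set ℓ) → Set ℓ
  AllIn i k P = ∀ j → i ≤ j → j ≤ i + k → P j

  -- B = L_i + ⋯ + L_{i+k} is a block (i + k < m assumed separately)
  data IsBlock (i k : ℕ) : Set₁ where
    blockA : AllIn i k SingletonAt →
             ((i ≡ 0) ⊎ (Σ ℕ λ j → (i ≡ suc j) × InfiniteAt j)) →
             ((suc (i + k) ≡ m) ⊎ InfiniteAt (suc (i + k))) →
             IsBlock i k
    blockB : AllIn i k ωAt →
             ((i ≡ 0) ⊎ (Σ ℕ λ j → (i ≡ suc (suc j)) × ωAt (suc j) × ω*At j)) →
             ((suc (i + k) ≡ m) ⊎ ¬ ωAt (suc (i + k))) →
             IsBlock i k
    blockC : AllIn i k ω*At →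
             ((i ≡ 0) ⊎ (Σ ℕ λ j → (i ≡ suc j) × ¬ ω*At j)) →
             ((suc (i + k) ≡ m) ⊎ (ω*At (suc (i + k)) × ωAt (suc (suc (i + k))))) →
             IsBlock i k
    blockD : k ≡ 1 → ω*At i → ωAt (suc i) → IsBlock i k

  InBlock : ℕ → ℕ → Carrier (FinSum Ls) → Set
  InBlock i k x = i ≤ toℕ (proj₁ x) × toℕ (proj₁ x) ≤ i + k

module Submission where

-- Call an order right-closed if it is a
-- singleton or an ω-sum, left-closed if it is a singleton or an ω*-sum.  Both
-- ends of a block are ends of L or "rigid cuts" (just after a right-closed
-- or just before a left-closed summand), and f never moves a point across a
-- rigid cut.
-- Classical logic enters only through ¬¬-excluded-middle, when proving ⊥.

open import Defs
open import Data.Nat using (ℕ; zero; suc; _+_; _<_; _≤_; z≤n; s≤s; _≤?_)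
open import Data.Nat.Properties
  using (≤-refl; ≤-trans; ≤-antisym; <⇒≤; ≰⇒>; ≤∧≢⇒<; ≤-pred; n≮n; n≮0; <-trans;
         ≤-<-trans; m≤n⇒m<n∨m≡n; m≤n⇒m≤1+n; m≤m+n; +-suc; +-identityʳ; +-comm; suc-injective)
open import Data.Fin using (Fin; toℕ; fromℕ; fromℕ<; inject₁)
import Data.Fin as F
import Data.Fin.Properties as FP
open import Data.Fin.Induction using (<-weakInduction; >-weakInduction)
open import Data.Vec.Functional using (_∷_)
open import Data.Unit using (tt)
open import Data.Empty using (⊥; ⊥-elim)
open import Data.Product using (Σ; _×_; _,_; proj₁; proj₂)
open import Data.Sum using (_⊎_; inj₁; inj₂)
open import Function using (_∘_)
open import Relation.Nullary using (¬_; Dec; yes; no)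
open import Relation.Nullary.Decidable using (decidable-stable; ¬¬-excluded-middle)
open import Relation.Binary.PropositionalEquality
  using (_≡_; refl; sym; trans; cong; subst)

-- Order embeddings packaged as a record, so that the orders involved can
-- be inferred; `fromDefs`/`toDefs` convert to and from the Σ-type of Defs.
record _↣_ (X Y : Ord) : Set where
  constructor embedding
  field
    fun  : Carrier X → Carrier Y
    mono : ∀ {x y} → _≺_ X x y → _≺_ Y (fun x) (fun y)
open _↣_ public

fromDefs : {X Y : Ord} → X ↪ Y → X ↣ Y
fromDefs (f , m) = embedding f (m _ _)

toDefs : {X Y : Ord} → X ↣ Y → X ↪ Y
toDefs e = fun e , λ _ _ → mono e

idE : {X : Ord} → X ↣ X
idE = embedding (λ x → x) (λ p → p)

infixr 9 _∘E_
_∘E_ : {X Y Z : Ord} → Y ↣ Z → X ↣ Y → X ↣ Z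
g ∘E f = embedding (λ x → fun g (fun f x)) (λ p → mono g (mono f p))

Weak : (X : Ord) → Carrier X → Carrier X → Set
Weak X x y = x ≡ y ⊎ _≺_ X x y

weak-map : {X Y : Ord} (e : X ↣ Y) {x y : Carrier X} →
           Weak X x y → Weak Y (fun e x) (fun e y)
weak-map e (inj₁ refl) = inj₁ refl
weak-map e (inj₂ p)    = inj₂ (mono e p)

iso⇒E : {X Y : Ord} → X ≅ Y → X ↣ Y
iso⇒E i = embedding (_≅_.to i) (_≅_.to-mono i _ _)

≅-refl : {X : Ord} → X ≅ X
≅-refl = record
  { to = λ x → x ; from = λ x → x ; from-to = λ _ → refl ; to-from = λ _ → refl
  ; to-mono = λ _ _ p → p ; from-mono = λ _ _ p → p }

≅-sym : {X Y : Ord} → X ≅ Y → Y ≅ X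
≅-sym i = record
  { to = from ; from = to ; from-to = to-from ; to-from = from-to
  ; to-mono = from-mono ; from-mono = to-mono }
  where open _≅_ i

≅-trans : {X Y Z : Ord} → X ≅ Y → Y ≅ Z → X ≅ Z
≅-trans i j = record
  { to = λ x → J.to (I.to x) ; from = λ z → I.from (J.from z)
  ; from-to = λ x → trans (cong I.from (J.from-to (I.to x))) (I.from-to x)
  ; to-from = λ z → trans (cong J.to (I.to-from (J.from z))) (J.to-from z)
  ; to-mono = λ _ _ p → J.to-mono _ _ (I.to-mono _ _ p)
  ; from-mono = λ _ _ p → I.from-mono _ _ (J.from-mono _ _ p) }
  where
    module I = _≅_ i
    module J = _≅_ j

-- The reverse order.  Note that op (op X) is definitionally X, so op↣ also
-- turns an embedding of reversed orders back into one of the originals.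
op : Ord → Ord
op X = record { Carrier = Carrier X ; _≺_ = λ x y → _≺_ X y x }

op↣ : {X Y : Ord} → X ↣ Y → op X ↣ op Y
op↣ e = embedding (fun e) (mono e)

op≅ : {X Y : Ord} → X ≅ Y → op X ≅ op Y
op≅ i = record
  { to = to ; from = from ; from-to = from-to ; to-from = to-from
  ; to-mono = λ x y p → to-mono y x p ; from-mono = λ x y p → from-mono y x p }
  where open _≅_ i

weak-op : {X : Ord} {x y : Carrier X} → Weak (op X) x y → Weak X y x
weak-op (inj₁ e) = inj₁ (sym e)
weak-op (inj₂ p) = inj₂ p

module _ {I : Set} {R : I → I → Set} {M : I → Ord} where

  ι : (i : I) → M i ↣ IndexedSum R M
  ι i = embedding (i ,_) intra

  valueAt : (u : Carrier (IndexedSum R M)) {i : I} → proj₁ u ≡ i → Carrier (M i)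
  valueAt (i , a) refl = a

  valueAt-eta : (u : Carrier (IndexedSum R M)) {i : I} (p : proj₁ u ≡ i) →
                (i , valueAt u p) ≡ u
  valueAt-eta (i , a) refl = refl

  valueAt-≺ : (∀ i → ¬ R i i) → ∀ {u v i} (p : proj₁ u ≡ i) (q : proj₁ v ≡ i) →
              LexLt R M u v → _≺_ (M i) (valueAt u p) (valueAt v q)
  valueAt-≺ irr refl refl (inter r) = ⊥-elim (irr _ r)
  valueAt-≺ irr refl refl (intra r) = r

  restrict : (∀ i → ¬ R i i) → {X : Ord} (e : X ↣ IndexedSum R M) (i : I) →
             (∀ x → proj₁ (fun e x) ≡ i) → X ↣ M i
  restrict irr e i p =
    embedding (λ x → valueAt (fun e x) (p x)) (λ {x} {y} q → valueAt-≺ irr (p x) (p y) (mono e q))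

  op-sum : op (IndexedSum R M) ≅ IndexedSum (λ i j → R j i) (λ i → op (M i))
  op-sum = record
    { to = λ u → u ; from = λ u → u ; from-to = λ _ → refl ; to-from = λ _ → refl
    ; to-mono = λ _ _ → flipped ; from-mono = λ _ _ → unflipped }
    where
      flipped : ∀ {u v} → LexLt R M v u → LexLt (λ i j → R j i) (λ i → op (M i)) u v
      flipped (inter r) = inter r
      flipped (intra p) = intra p
      unflipped : ∀ {u v} → LexLt (λ i j → R j i) (λ i → op (M i)) u v → LexLt R M v u
      unflipped (inter r) = inter r
      unflipped (intra p) = intra p

index-mono : {M : ℕ → Ord} {u v : Carrier (ωSum M)} → _≺_ (ωSum M) u v → proj₁ u ≤ proj₁ v
index-mono (inter r) = <⇒≤ r
index-mono (intra _) = ≤-refl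

Singleton : Ord → Set
Singleton X = Σ (Carrier X) λ x → ∀ y → y ≡ x

singleton-𝟙 : {X : Ord} → X ≅ 𝟙 → Singleton X
singleton-𝟙 i = _≅_.from i tt , λ y → sym (_≅_.from-to i y)

point : {X : Ord} → IsH X → Carrier X
point (one _ i)          = _≅_.from i tt
point (ωs _ _ hs _ i)    = _≅_.from i (0 , point (hs 0))
point (ω*s _ _ hs _ i)   = _≅_.from i (0 , point (hs 0))

H-≅ : {X Y : Ord} → X ≅ Y → IsH X → IsH Y
H-≅ i (one _ j)          = one _ (≅-trans (≅-sym i) j)
H-≅ i (ωs _ Ls hs st j)  = ωs _ Ls hs st (≅-trans (≅-sym i) j)
H-≅ i (ω*s _ Ls hs st j) = ω*s _ Ls hs st (≅-trans (≅-sym i) j)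

op-Star : {Ls : ℕ → Ord} → Star Ls → Star (λ i → op (Ls i))
op-Star st i n with st i n
... | j , n≤j , (e , e-mono) = j , n≤j , (e , λ x y q → e-mono y x q)

opH : {X : Ord} → IsH X → IsH (op X)
opH (one _ i)          = one _ (op≅ i)
opH (ωs _ Ls hs st i)  = ω*s _ _ (λ j → opH (hs j)) (op-Star st) (≅-trans (op≅ i) op-sum)
opH (ω*s _ Ls hs st i) = ωs _ _ (λ j → opH (hs j)) (op-Star st) (≅-trans (op≅ i) op-sum)

op-ω*Sum : {X : Ord} → Isω*Sum X → IsωSum (op X)
op-ω*Sum (Ls , hs , st , i) =
  (λ j → op (Ls j)) , (λ j → opH (hs j)) , op-Star st , ≅-trans (op≅ i) op-sum

-- Shifts: by (*), an ω-sum can be pushed above any of its points, and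
-- dually an ω*-sum below any of its points.

RShift : Ord → Set
RShift X = ∀ w → Σ (X ↣ X) λ h → ∀ x → _≺_ X w (fun h x)

LShift : Ord → Set
LShift X = RShift (op X)

RShift-≅ : {X Y : Ord} → X ≅ Y → RShift Y → RShift X
RShift-≅ {X} i sh w =
  iso⇒E (≅-sym i) ∘E h ∘E iso⇒E i ,
  λ x → subst (λ v → _≺_ X v (from (fun h (to x)))) (from-to w) (from-mono _ _ (above (to x)))
  where
    open _≅_ i
    h = proj₁ (sh (to w))
    above = proj₂ (sh (to w))

increasing-mono : (g : ℕ → ℕ) → (∀ i → g i < g (suc i)) → ∀ {i j} → i < j → g i < g j
increasing-mono g inc {i} {suc j} (s≤s i≤j) with m≤n⇒m<n∨m≡n i≤j
... | inj₁ i<j  = <-trans (increasing-mono g inc i<j) (inc j)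
... | inj₂ refl = inc i

-- Condition (*) lets us send the summands of an ω-sum, in order, to
-- summands of strictly increasing index beyond any given one.
module ωShift {Ls : ℕ → Ord} (st : Star Ls) (a : ℕ) where

  target : ℕ → ℕ
  target zero    = proj₁ (st 0 (suc a))
  target (suc i) = proj₁ (st (suc i) (suc (target i)))

  step : ∀ i → Ls i ↣ Ls (target i)
  step zero    = fromDefs (proj₂ (proj₂ (st 0 (suc a))))
  step (suc i) = fromDefs (proj₂ (proj₂ (st (suc i) (suc (target i)))))

  target-inc : ∀ i → target i < target (suc i)
  target-inc i = proj₁ (proj₂ (st (suc i) (suc (target i))))

  target-above : ∀ i → a < target i
  target-above zero    = proj₁ (proj₂ (st 0 (suc a)))
  target-above (suc i) = <-trans (target-above i) (target-inc i)

  shift : ωSum Ls ↣ ωSum Ls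
  shift = embedding (λ { (i , x) → target i , fun (step i) x }) shift-mono
    where
      shift-mono : ∀ {u v} → LexLt _<_ Ls u v →
                   LexLt _<_ Ls (target (proj₁ u) , fun (step (proj₁ u)) (proj₂ u))
                                (target (proj₁ v) , fun (step (proj₁ v)) (proj₂ v))
      shift-mono (inter r) = inter (increasing-mono target target-inc r)
      shift-mono (intra p) = intra (mono (step _) p)

ωSum-RShift : {Ls : ℕ → Ord} → Star Ls → RShift (ωSum Ls)
ωSum-RShift st (a , _) = shift , λ { (i , _) → inter (target-above i) }
  where open ωShift st a

IsωSum-RShift : {X : Ord} → IsωSum X → RShift X
IsωSum-RShift (_ , _ , st , i) = RShift-≅ i (ωSum-RShift st)

Isω*Sum-LShift : {X : Ord} → Isω*Sum X → LShift X
Isω*Sum-LShift s = IsωSum-RShift (op-ω*Sum s)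

-- If X ∈ 𝓗 embeds into ωSum M with all images in summands lo … lo+n, then
-- (classically) X embeds into a single summand M r: a singleton trivially;
-- if X is right-shiftable and some point reaches summand lo+n, push X above
-- that point, otherwise shrink the range from the top; dually from the
-- bottom for left-shiftable X.

index : {X : Ord} {M : ℕ → Ord} → X ↣ ωSum M → Carrier X → ℕ
index e x = proj₁ (fun e x)

IntoSummand : Ord → (ℕ → Ord) → Set
IntoSummand X M = Σ ℕ λ r → X ↣ M r

into-summand : {X : Ord} {M : ℕ → Ord} (e : X ↣ ωSum M) (r : ℕ) →
               (∀ x → index e x ≡ r) → IntoSummand X M
into-summand e r p = r , restrict (λ i → n≮n i) e r p

collapse-right : {X : Ord} {M : ℕ → Ord} → RShift X → (e : X ↣ ωSum M) →
                 ∀ n lo → (∀ x → lo ≤ index e x) → (∀ x → index e x ≤ lo + n) →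
                 ¬ ¬ IntoSummand X M
collapse-right sh e zero lo lb ub done =
  done (into-summand e lo λ x → ≤-antisym (subst (_ ≤_) (+-identityʳ lo) (ub x)) (lb x))
collapse-right {X} sh e (suc n) lo lb ub done =
  ¬¬-excluded-middle {A = Σ (Carrier X) λ x → index e x ≡ lo + suc n} λ where
    (yes (x , top)) → done (into-summand (e ∘E proj₁ (sh x)) (lo + suc n) λ y →
      ≤-antisym (ub _) (subst (_≤ index e (fun (proj₁ (sh x)) y)) top
                               (index-mono (mono e (proj₂ (sh x) y)))))
    (no none) → collapse-right sh e n lo lb
      (λ y → ≤-pred (subst (index e y <_) (+-suc lo n) (≤∧≢⇒< (ub y) λ eq → none (y , eq))))
      done

collapse-left : {X : Ord} {M : ℕ → Ord} → LShift X → (e : X ↣ ωSum M) →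
                ∀ n lo → (∀ x → lo ≤ index e x) → (∀ x → index e x ≤ lo + n) →
                ¬ ¬ IntoSummand X M
collapse-left sh e zero lo lb ub done =
  done (into-summand e lo λ x → ≤-antisym (subst (_ ≤_) (+-identityʳ lo) (ub x)) (lb x))
collapse-left {X} sh e (suc n) lo lb ub done =
  ¬¬-excluded-middle {A = Σ (Carrier X) λ x → index e x ≡ lo} λ where
    (yes (x , bottom)) → done (into-summand (e ∘E op↣ (proj₁ (sh x))) lo λ y →
      ≤-antisym (subst (_ ≤_) bottom (index-mono (mono e (proj₂ (sh x) y)))) (lb _))
    (no none) → collapse-left sh e n (suc lo)
      (λ y → ≤∧≢⇒< (lb y) λ eq → none (y , sym eq))
      (λ y → subst (index e y ≤_) (+-suc lo n) (ub y))
      done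

collapse : {X : Ord} {M : ℕ → Ord} → IsH X → (e : X ↣ ωSum M) (hi : ℕ) →
           (∀ x → index e x ≤ hi) → ¬ ¬ IntoSummand X M
collapse (one _ i) e hi ub done =
  done (into-summand e (index e x₀) λ x → cong (index e) (proj₂ (singleton-𝟙 i) x))
  where x₀ = proj₁ (singleton-𝟙 i)
collapse (ωs _ Ls hs st i) e hi ub =
  collapse-right (IsωSum-RShift (Ls , hs , st , i)) e hi 0 (λ _ → z≤n) ub
collapse (ω*s _ Ls hs st i) e hi ub =
  collapse-left (Isω*Sum-LShift (Ls , hs , st , i)) e hi 0 (λ _ → z≤n) ub

NoDouble : Ord → Set
NoDouble Y = (g₁ g₂ : Y ↣ Y) → ¬ (∀ a b → _≺_ Y (fun g₁ a) (fun g₂ b))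

NoDouble-≅ : {X Y : Ord} → X ≅ Y → NoDouble Y → NoDouble X
NoDouble-≅ i nd g₁ g₂ below =
  nd (iso⇒E i ∘E g₁ ∘E iso⇒E (≅-sym i)) (iso⇒E i ∘E g₂ ∘E iso⇒E (≅-sym i))
     (λ a b → _≅_.to-mono i _ _ (below _ _))

NoDouble-op : {X : Ord} → NoDouble X → NoDouble (op X)
NoDouble-op nd g₁ g₂ below = nd (op↣ g₂) (op↣ g₁) (λ a b → below b a)

-- Under (*), an ω-sum of such orders does not embed into one of its summands:
-- composing with the inclusion of Lᵣ, and with Lᵣ ↪ Lⱼ (j > r) followed by
-- the inclusion of Lⱼ, gives two self-embeddings of Lᵣ one below the other.
ωSum-not-into-summand : {Ls : ℕ → Ord} → Star Ls → (∀ i → NoDouble (Ls i)) →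
                        ¬ IntoSummand (ωSum Ls) Ls
ωSum-not-into-summand st nd (r , E) with st r (suc r)
... | j , r<j , Lr↪Lj =
  nd r (E ∘E ι r) (E ∘E ι j ∘E fromDefs Lr↪Lj) (λ a b → mono E (inter r<j))

ωSum-unbounded : {Ls : ℕ → Ord} → Star Ls → (∀ i → NoDouble (Ls i)) →
                 (h : ωSum Ls ↣ ωSum Ls) (w : Carrier (ωSum Ls)) →
                 ¬ (∀ x → _≺_ (ωSum Ls) (fun h x) w)
ωSum-unbounded st nd h w below =
  collapse-right (ωSum-RShift st) h (proj₁ w) 0 (λ _ → z≤n) (λ x → index-mono (below x))
    (ωSum-not-into-summand st nd)

-- an ω-sum of NoDouble orders is NoDouble: g₁ is bounded above by any point
-- of the image of g₂
ωSum-NoDouble : {Ls : ℕ → Ord} → Star Ls → (∀ i → NoDouble (Ls i)) →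
                Carrier (Ls 0) → NoDouble (ωSum Ls)
ωSum-NoDouble st nd a₀ g₁ g₂ below =
  ωSum-unbounded st nd g₁ (fun g₂ (0 , a₀)) (λ x → below x (0 , a₀))

noDoubleH : {Y : Ord} → IsH Y → NoDouble Y
noDoubleH (one _ i) g₁ g₂ below = _≅_.to-mono i _ _ (below y₀ y₀)
  where y₀ = _≅_.from i tt
noDoubleH (ωs _ Ls hs st i) =
  NoDouble-≅ i (ωSum-NoDouble st (λ j → noDoubleH (hs j)) (point (hs 0)))
noDoubleH (ω*s _ Ls hs st i) =
  NoDouble-≅ i (NoDouble-op (NoDouble-≅ op-sum
    (ωSum-NoDouble (op-Star st) (λ j → NoDouble-op (noDoubleH (hs j))) (point (hs 0)))))

RightClosed LeftClosed : Ord → Set₁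
RightClosed X = Singleton X ⊎ IsωSum X
LeftClosed X = Singleton X ⊎ Isω*Sum X

LeftClosed-op : {X : Ord} → LeftClosed X → RightClosed (op X)
LeftClosed-op (inj₁ s) = inj₁ s
LeftClosed-op (inj₂ s) = inj₂ (op-ω*Sum s)

classifyL : {X : Ord} → IsH X → LeftClosed X ⊎ IsωSum X
classifyL (one _ i)          = inj₁ (inj₁ (singleton-𝟙 i))
classifyL (ωs _ Ls hs st i)  = inj₂ (Ls , hs , st , i)
classifyL (ω*s _ Ls hs st i) = inj₁ (inj₂ (Ls , hs , st , i))

classifyR : {X : Ord} → IsH X → RightClosed X ⊎ Isω*Sum X
classifyR (one _ i)          = inj₁ (inj₁ (singleton-𝟙 i))
classifyR (ωs _ Ls hs st i)  = inj₁ (inj₂ (Ls , hs , st , i))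
classifyR (ω*s _ Ls hs st i) = inj₂ (Ls , hs , st , i)

raise : {X : Ord} → RightClosed X → ∀ b → Σ (X ↣ X) λ s → ∀ a → Weak X b (fun s a)
raise (inj₁ (x , unique)) b = idE , λ a → inj₁ (trans (unique b) (sym (unique a)))
raise (inj₂ ω) b = proj₁ (IsωSum-RShift ω b) , λ a → inj₂ (proj₂ (IsωSum-RShift ω b) a)

lower : {X : Ord} → LeftClosed X → ∀ b → Σ (X ↣ X) λ s → ∀ a → Weak X (fun s a) b
lower {X} lc b with raise (LeftClosed-op lc) b
... | s , above = op↣ s , λ a → weak-op {X} (above a)

RightClosed-unbounded : {X : Ord} → IsH X → RightClosed X → (h : X ↣ X) (w : Carrier X) →
                        ¬ (∀ a → _≺_ X (fun h a) w)
RightClosed-unbounded {X} hX (inj₁ (x , unique)) h w below =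
  noDoubleH hX h idE λ a b → subst (_≺_ X (fun h a)) (trans (unique w) (sym (unique b))) (below a)
RightClosed-unbounded hX (inj₂ (Ls , hs , st , i)) h w below =
  ωSum-unbounded st (λ j → noDoubleH (hs j)) (iso⇒E i ∘E h ∘E iso⇒E (≅-sym i)) (to w)
    (λ x → to-mono _ _ (below (from x)))
  where open _≅_ i

LeftClosed-unbounded : {X : Ord} → IsH X → LeftClosed X → (h : X ↣ X) (w : Carrier X) →
                       ¬ (∀ a → _≺_ X w (fun h a))
LeftClosed-unbounded hX lc h = RightClosed-unbounded (opH hX) (LeftClosed-op lc) (op↣ h)

data SumLt (A B : Ord) : Carrier A ⊎ Carrier B → Carrier A ⊎ Carrier B → Set where
  left<  : ∀ {a a'} → _≺_ A a a' → SumLt A B (inj₁ a) (inj₁ a')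
  right< : ∀ {b b'} → _≺_ B b b' → SumLt A B (inj₂ b) (inj₂ b')
  cross  : ∀ {a b} → SumLt A B (inj₁ a) (inj₂ b)

infixr 6 _⊕_
_⊕_ : Ord → Ord → Ord
A ⊕ B = record { Carrier = Carrier A ⊎ Carrier B ; _≺_ = SumLt A B }

⊕-cong : {A A' B B' : Ord} → A ≅ A' → B ≅ B' → (A ⊕ B) ≅ (A' ⊕ B')
⊕-cong {A} {A'} {B} {B'} i j = record
  { to = t ; from = f ; from-to = ft ; to-from = tf
  ; to-mono = λ _ _ → tm ; from-mono = λ _ _ → fm }
  where
    module I = _≅_ i
    module J = _≅_ j
    t : Carrier (A ⊕ B) → Carrier (A' ⊕ B')
    t (inj₁ a) = inj₁ (I.to a)
    t (inj₂ b) = inj₂ (J.to b)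
    f : Carrier (A' ⊕ B') → Carrier (A ⊕ B)
    f (inj₁ a) = inj₁ (I.from a)
    f (inj₂ b) = inj₂ (J.from b)
    ft : ∀ x → f (t x) ≡ x
    ft (inj₁ a) = cong inj₁ (I.from-to a)
    ft (inj₂ b) = cong inj₂ (J.from-to b)
    tf : ∀ x → t (f x) ≡ x
    tf (inj₁ a) = cong inj₁ (I.to-from a)
    tf (inj₂ b) = cong inj₂ (J.to-from b)
    tm : ∀ {x y} → SumLt A B x y → SumLt A' B' (t x) (t y)
    tm (left< p)  = left< (I.to-mono _ _ p)
    tm (right< p) = right< (J.to-mono _ _ p)
    tm cross      = cross
    fm : ∀ {x y} → SumLt A' B' x y → SumLt A B (f x) (f y)
    fm (left< p)  = left< (I.from-mono _ _ p)
    fm (right< p) = right< (J.from-mono _ _ p)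
    fm cross      = cross

⊕-assoc : {A B C : Ord} → (A ⊕ (B ⊕ C)) ≅ ((A ⊕ B) ⊕ C)
⊕-assoc {A} {B} {C} = record
  { to = t ; from = f ; from-to = ft ; to-from = tf
  ; to-mono = λ _ _ → tm ; from-mono = λ _ _ → fm }
  where
    t : Carrier (A ⊕ (B ⊕ C)) → Carrier ((A ⊕ B) ⊕ C)
    t (inj₁ a)        = inj₁ (inj₁ a)
    t (inj₂ (inj₁ b)) = inj₁ (inj₂ b)
    t (inj₂ (inj₂ c)) = inj₂ c
    f : Carrier ((A ⊕ B) ⊕ C) → Carrier (A ⊕ (B ⊕ C))
    f (inj₁ (inj₁ a)) = inj₁ a
    f (inj₁ (inj₂ b)) = inj₂ (inj₁ b)
    f (inj₂ c)        = inj₂ (inj₂ c)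
    ft : ∀ x → f (t x) ≡ x
    ft (inj₁ a)        = refl
    ft (inj₂ (inj₁ b)) = refl
    ft (inj₂ (inj₂ c)) = refl
    tf : ∀ x → t (f x) ≡ x
    tf (inj₁ (inj₁ a)) = refl
    tf (inj₁ (inj₂ b)) = refl
    tf (inj₂ c)        = refl
    tm : ∀ {x y} → SumLt A (B ⊕ C) x y → SumLt (A ⊕ B) C (t x) (t y)
    tm (left< p)                     = left< (left< p)
    tm (right< (left< p))            = left< (right< p)
    tm (right< (right< p))           = right< p
    tm (right< cross)                = cross
    tm {y = inj₂ (inj₁ _)} cross     = left< cross
    tm {y = inj₂ (inj₂ _)} cross     = cross
    fm : ∀ {x y} → SumLt (A ⊕ B) C x y → SumLt A (B ⊕ C) (f x) (f y)
    fm (left< (left< p))             = left< p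
    fm (left< (right< p))            = right< (left< p)
    fm (left< cross)                 = cross
    fm (right< p)                    = right< (right< p)
    fm {x = inj₁ (inj₁ _)} cross     = cross
    fm {x = inj₁ (inj₂ _)} cross     = right< cross

op-⊕ : {A B : Ord} → op (A ⊕ B) ≅ (op B ⊕ op A)
op-⊕ {A} {B} = record
  { to = swap ; from = swap ; from-to = swap² ; to-from = swap²
  ; to-mono = λ _ _ → tm ; from-mono = λ _ _ → fm }
  where
    swap : {P Q : Set} → P ⊎ Q → Q ⊎ P
    swap (inj₁ p) = inj₂ p
    swap (inj₂ q) = inj₁ q
    swap² : {P Q : Set} (x : P ⊎ Q) → swap (swap x) ≡ x
    swap² (inj₁ p) = refl
    swap² (inj₂ q) = refl
    tm : ∀ {x y} → SumLt A B y x → SumLt (op B) (op A) (swap x) (swap y)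
    tm (left< p)  = right< p
    tm (right< p) = left< p
    tm cross      = cross
    fm : ∀ {x y} → SumLt (op B) (op A) x y → SumLt A B (swap y) (swap x)
    fm (left< p)  = right< p
    fm (right< p) = left< p
    fm cross      = cross

_◅_ : Ord → (ℕ → Ord) → ℕ → Ord
(A ◅ M) zero    = A
(A ◅ M) (suc i) = M i

⊕-ωSum : (A : Ord) (M : ℕ → Ord) → (A ⊕ ωSum M) ≅ ωSum (A ◅ M)
⊕-ωSum A M = record
  { to = t ; from = f ; from-to = ft ; to-from = tf
  ; to-mono = λ _ _ → tm ; from-mono = λ _ _ → fm }
  where
    t : Carrier (A ⊕ ωSum M) → Carrier (ωSum (A ◅ M))
    t (inj₁ a)       = zero , a
    t (inj₂ (i , b)) = suc i , b
    f : Carrier (ωSum (A ◅ M)) → Carrier (A ⊕ ωSum M)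
    f (zero , a)  = inj₁ a
    f (suc i , b) = inj₂ (i , b)
    ft : ∀ x → f (t x) ≡ x
    ft (inj₁ a)       = refl
    ft (inj₂ (i , b)) = refl
    tf : ∀ x → t (f x) ≡ x
    tf (zero , a)  = refl
    tf (suc i , b) = refl
    tm : ∀ {x y} → SumLt A (ωSum M) x y → LexLt _<_ (A ◅ M) (t x) (t y)
    tm (left< p)          = intra p
    tm (right< (inter r)) = inter (s≤s r)
    tm (right< (intra p)) = intra p
    tm cross              = inter (s≤s z≤n)
    fm : ∀ {x y} → LexLt _<_ (A ◅ M) x y → SumLt A (ωSum M) (f x) (f y)
    fm {zero , _}  {suc _ , _} (inter r)       = cross
    fm {suc _ , _} {suc _ , _} (inter (s≤s r)) = right< (inter r)
    fm {zero , _}              (intra p)       = left< p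
    fm {suc _ , _}             (intra p)       = right< (intra p)

◅-Star : {A : Ord} {M : ℕ → Ord} {r : ℕ} → A ↣ M r → Star M → Star (A ◅ M)
◅-Star {M = M} {r} e st zero n with st r n
... | j , n≤j , Mr↪Mj = suc j , m≤n⇒m≤1+n n≤j , toDefs (fromDefs {M r} {M j} Mr↪Mj ∘E e)
◅-Star e st (suc i) n with st i n
... | j , n≤j , Mi↪Mj = suc j , m≤n⇒m≤1+n n≤j , Mi↪Mj

◅-H : {A : Ord} {M : ℕ → Ord} → IsH A → (∀ i → IsH (M i)) → ∀ i → IsH ((A ◅ M) i)
◅-H hA hM zero    = hA
◅-H hA hM (suc i) = hM i

-- If A ∈ 𝓗 embeds into an ω-sum B strictly below some point of B, then
-- A + B ∈ 𝓗: by `collapse`, A embeds into a summand of B, so A + B is the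
-- ω-sum of A followed by the summands of B, and it satisfies (*).
absorbRight : {A B : Ord} → IsH A → IsωSum B → (e : A ↣ B) (w : Carrier B) →
              (∀ a → _≺_ B (fun e a) w) → ¬ ¬ IsH (A ⊕ B)
absorbRight {A} {B} hA (M , hM , stM , i) e w below done =
  collapse hA (iso⇒E i ∘E e) (proj₁ (to w)) (λ a → index-mono (to-mono _ _ (below a)))
    λ (r , E) → done (ωs (A ⊕ B) (A ◅ M) (◅-H hA hM) (◅-Star E stM)
                        (≅-trans (⊕-cong ≅-refl i) (⊕-ωSum A M)))
  where open _≅_ i

absorbLeft : {A B : Ord} → IsH B → Isω*Sum A → (e : B ↣ A) (w : Carrier A) →
             (∀ b → _≺_ A w (fun e b)) → ¬ ¬ IsH (A ⊕ B)
absorbLeft hB ω*A e w above done =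
  absorbRight (opH hB) (op-ω*Sum ω*A) (op↣ e) w above λ H → done (H-≅ op-⊕ (opH H))

FinSum-uncons : ∀ {n} (Ls : Fin (suc n) → Ord) →
                FinSum Ls ≅ (Ls F.zero ⊕ FinSum (λ i → Ls (F.suc i)))
FinSum-uncons Ls = record
  { to = t ; from = f ; from-to = ft ; to-from = tf
  ; to-mono = λ _ _ → tm ; from-mono = λ _ _ → fm }
  where
    Tail = FinSum (λ i → Ls (F.suc i))
    t : Carrier (FinSum Ls) → Carrier (Ls F.zero ⊕ Tail)
    t (F.zero , a)  = inj₁ a
    t (F.suc i , a) = inj₂ (i , a)
    f : Carrier (Ls F.zero ⊕ Tail) → Carrier (FinSum Ls)
    f (inj₁ a)       = F.zero , a
    f (inj₂ (i , a)) = F.suc i , a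
    ft : ∀ x → f (t x) ≡ x
    ft (F.zero , a)  = refl
    ft (F.suc i , a) = refl
    tf : ∀ x → t (f x) ≡ x
    tf (inj₁ a)       = refl
    tf (inj₂ (i , a)) = refl
    tm : ∀ {x y} → LexLt F._<_ Ls x y → SumLt (Ls F.zero) Tail (t x) (t y)
    tm {F.zero , _}  {F.suc _ , _} (inter r)       = cross
    tm {F.suc _ , _} {F.suc _ , _} (inter (s≤s r)) = right< (inter r)
    tm {F.zero , _}                (intra p)       = left< p
    tm {F.suc _ , _}               (intra p)       = right< (intra p)
    fm : ∀ {x y} → SumLt (Ls F.zero) Tail x y → LexLt F._<_ Ls (f x) (f y)
    fm (left< p)          = intra p
    fm (right< (inter r)) = inter (s≤s r)
    fm (right< (intra p)) = intra p
    fm cross              = inter (s≤s z≤n)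

∷-H : ∀ {n} {A : Ord} {K : Fin n → Ord} → IsH A → (∀ t → IsH (K t)) → ∀ t → IsH ((A ∷ K) t)
∷-H hA hK F.zero    = hA
∷-H hA hK (F.suc t) = hK t

mergeAdjacent : ∀ {n} (Ls : Fin (suc n) → Ord) (i : Fin n) → (∀ k → IsH (Ls k)) →
                IsH (Ls (inject₁ i) ⊕ Ls (F.suc i)) → SumOfH n (FinSum Ls)
mergeAdjacent {suc n} Ls F.zero hs merged =
  (Ls F.zero ⊕ Ls (F.suc F.zero)) ∷ Rest , ∷-H merged (λ t → hs _) ,
  ≅-trans (FinSum-uncons Ls)
    (≅-trans (⊕-cong ≅-refl (FinSum-uncons (λ t → Ls (F.suc t))))
      (≅-trans ⊕-assoc (≅-sym (FinSum-uncons (_ ∷ Rest)))))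
  where Rest = λ t → Ls (F.suc (F.suc t))
mergeAdjacent {suc n} Ls (F.suc i) hs merged
  with mergeAdjacent (λ t → Ls (F.suc t)) i (λ t → hs _) merged
... | K , hK , iso =
  Ls F.zero ∷ K , ∷-H (hs _) hK ,
  ≅-trans (FinSum-uncons Ls) (≅-trans (⊕-cong ≅-refl iso) (≅-sym (FinSum-uncons (_ ∷ K))))

squeeze : ∀ {k a b c} → k ≤ a → a ≤ b → b ≤ c → c ≤ k → b ≡ k
squeeze k≤a a≤b b≤c c≤k = ≤-antisym (≤-trans b≤c c≤k) (≤-trans k≤a a≤b)

module Decomposition {n : ℕ} (Ls : Fin (suc n) → Ord) (hs : ∀ k → IsH (Ls k)) where

  L : Ord
  L = FinSum Ls

  pos : Carrier L → ℕ
  pos x = toℕ (proj₁ x)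

  pos-mono : ∀ {x y} → _≺_ L x y → pos x ≤ pos y
  pos-mono (inter r) = <⇒≤ r
  pos-mono (intra _) = ≤-refl

  pos-weak : ∀ {x y} → Weak L x y → pos x ≤ pos y
  pos-weak (inj₁ refl) = ≤-refl
  pos-weak (inj₂ p)    = pos-mono p

  weak-ι : ∀ {k a b} → Weak (Ls k) a b → Weak L (k , a) (k , b)
  weak-ι (inj₁ refl) = inj₁ refl
  weak-ι (inj₂ p)    = inj₂ (intra p)

  Fin-irrefl : ∀ (k : Fin (suc n)) → ¬ k F.< k
  Fin-irrefl k = n≮n (toℕ k)

  valueIn : ∀ k (x : Carrier L) → pos x ≡ toℕ k → Carrier (Ls k)
  valueIn k x p = valueAt {R = F._<_} {M = Ls} x (FP.toℕ-injective p)

  valueIn-eta : ∀ k z (p : pos z ≡ toℕ k) → (k , valueIn k z p) ≡ z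
  valueIn-eta k z p = valueAt-eta {R = F._<_} {M = Ls} z (FP.toℕ-injective p)

  valueIn-≺ : ∀ k {x y} (p : pos x ≡ toℕ k) (q : pos y ≡ toℕ k) →
              _≺_ L x y → _≺_ (Ls k) (valueIn k x p) (valueIn k y q)
  valueIn-≺ k p q = valueAt-≺ Fin-irrefl (FP.toℕ-injective p) (FP.toℕ-injective q)

  restrictTo : ∀ {X : Ord} (e : X ↣ L) k → (∀ x → pos (fun e x) ≡ toℕ k) → X ↣ Ls k
  restrictTo e k p = restrict Fin-irrefl e k (λ x → FP.toℕ-injective (p x))

  firstAt : ∀ k {z} → toℕ k ≤ pos z → Σ (Carrier (Ls k)) λ b → Weak L (k , b) z
  firstAt k {z} k≤z with m≤n⇒m<n∨m≡n k≤z
  ... | inj₁ k<z = point (hs k) , inj₂ (inter k<z)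
  ... | inj₂ k≡z = valueIn k z (sym k≡z) , inj₁ (valueIn-eta k z (sym k≡z))

  lastAt : ∀ k {z} → pos z ≤ toℕ k → Σ (Carrier (Ls k)) λ b → Weak L z (k , b)
  lastAt k {z} z≤k with m≤n⇒m<n∨m≡n z≤k
  ... | inj₁ z<k = point (hs k) , inj₂ (inter z<k)
  ... | inj₂ z≡k = valueIn k z z≡k , inj₁ (sym (valueIn-eta k z z≡k))

  TailShift : L ↣ L → Fin (suc n) → Set
  TailShift g k = ∀ x → toℕ k ≤ pos x → toℕ k < pos (fun g x)

  HeadShift : L ↣ L → Fin (suc n) → Set
  HeadShift g k = ∀ x → pos x ≤ toℕ k → pos (fun g x) < toℕ k

  tailShiftOrStuck : (g : L ↣ L) (k : Fin (suc n)) →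
    ¬ ¬ (TailShift g k ⊎ Σ (Carrier (Ls k)) λ b → pos (fun g (k , b)) ≤ toℕ k)
  tailShiftOrStuck g k done =
    ¬¬-excluded-middle {A = Σ (Carrier L) λ z → toℕ k ≤ pos z × pos (fun g z) ≤ toℕ k} λ where
      (yes (z , k≤z , gz≤k)) → done (inj₂ (proj₁ (firstAt k k≤z) ,
        ≤-trans (pos-weak (weak-map g (proj₂ (firstAt k k≤z)))) gz≤k))
      (no none) → done (inj₁ λ z k≤z → ≰⇒> λ gz≤k → none (z , k≤z , gz≤k))

  headShiftOrStuck : (g : L ↣ L) (k : Fin (suc n)) →
    ¬ ¬ (HeadShift g k ⊎ Σ (Carrier (Ls k)) λ b → toℕ k ≤ pos (fun g (k , b)))
  headShiftOrStuck g k done =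
    ¬¬-excluded-middle {A = Σ (Carrier L) λ z → pos z ≤ toℕ k × toℕ k ≤ pos (fun g z)} λ where
      (yes (z , z≤k , k≤gz)) → done (inj₂ (proj₁ (lastAt k z≤k) ,
        ≤-trans k≤gz (pos-weak (weak-map g (proj₂ (lastAt k z≤k))))))
      (no none) → done (inj₁ λ z z≤k → ≰⇒> λ k≤gz → none (z , z≤k , k≤gz))

  -- A left-closed summand Lₖ cannot be trapped: if g sends a point y before
  -- Lₖ into position k and some point b of Lₖ to position at most k, then
  -- g maps all of Lₖ, lowered below b, into Lₖ above g y — a self-embedding
  -- of Lₖ bounded below.
  trappedL : ∀ {k} → LeftClosed (Ls k) → (g : L ↣ L) (y : Carrier L) →
             pos y < toℕ k → toℕ k ≤ pos (fun g y) →
             (b : Carrier (Ls k)) → ¬ (pos (fun g (k , b)) ≤ toℕ k)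
  trappedL {k} lc g y y<k k≤gy b gb≤k =
    LeftClosed-unbounded (hs k) lc (restrictTo (g ∘E ι k ∘E s) k sa-at-k) (valueIn k (fun g y) gy-at-k)
      (λ a → valueIn-≺ k gy-at-k (sa-at-k a) (mono g (inter y<k)))
    where
      s = proj₁ (lower lc b)
      gy≤gb : pos (fun g y) ≤ pos (fun g (k , b))
      gy≤gb = pos-mono (mono g (inter y<k))
      gy-at-k : pos (fun g y) ≡ toℕ k
      gy-at-k = squeeze k≤gy ≤-refl gy≤gb gb≤k
      sa-at-k : ∀ a → pos (fun g (k , fun s a)) ≡ toℕ k
      sa-at-k a = squeeze k≤gy (pos-mono (mono g (inter y<k)))
                    (pos-weak (weak-map g (weak-ι (proj₂ (lower lc b) a)))) gb≤k

  trappedR : ∀ {k} → RightClosed (Ls k) → (g : L ↣ L) (y : Carrier L) →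
             toℕ k < pos y → pos (fun g y) ≤ toℕ k →
             (b : Carrier (Ls k)) → ¬ (toℕ k ≤ pos (fun g (k , b)))
  trappedR {k} rc g y k<y gy≤k b k≤gb =
    RightClosed-unbounded (hs k) rc (restrictTo (g ∘E ι k ∘E s) k sa-at-k) (valueIn k (fun g y) gy-at-k)
      (λ a → valueIn-≺ k (sa-at-k a) gy-at-k (mono g (inter k<y)))
    where
      s = proj₁ (raise rc b)
      gb≤gy : pos (fun g (k , b)) ≤ pos (fun g y)
      gb≤gy = pos-mono (mono g (inter k<y))
      gy-at-k : pos (fun g y) ≡ toℕ k
      gy-at-k = squeeze k≤gb gb≤gy ≤-refl gy≤k
      sa-at-k : ∀ a → pos (fun g (k , fun s a)) ≡ toℕ k
      sa-at-k a = squeeze k≤gb (pos-weak (weak-map g (weak-ι (proj₂ (raise rc b) a))))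
                    (pos-mono (mono g (inter k<y))) gy≤k

  private
    update : ∀ k → (Carrier (Ls k) → Carrier (Ls k)) →
             ∀ j → Dec (j ≡ k) → Carrier (Ls j) → Carrier (Ls j)
    update k σ j (yes refl) a = σ a
    update k σ j (no _)     a = a

    update-mono : ∀ {k} (σ : Ls k ↣ Ls k) {j} (d : Dec (j ≡ k)) {a a'} →
                  _≺_ (Ls j) a a' → _≺_ (Ls j) (update k (fun σ) j d a) (update k (fun σ) j d a')
    update-mono σ (yes refl) p = mono σ p
    update-mono σ (no _)     p = p

    update-self : ∀ {k} (σ : Carrier (Ls k) → Carrier (Ls k)) (d : Dec (k ≡ k)) a →
                  update k σ k d a ≡ σ a
    update-self σ (yes refl) a = refl
    update-self σ (no k≢k)   a = ⊥-elim (k≢k refl)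

  extendAt : ∀ k → Ls k ↣ Ls k → L ↣ L
  extendAt k σ = embedding (λ { (j , a) → j , update k (fun σ) j (j F.≟ k) a }) extend-mono
    where
      extend-mono : ∀ {x y} → _≺_ L x y →
        _≺_ L (proj₁ x , update k (fun σ) _ (proj₁ x F.≟ k) (proj₂ x))
              (proj₁ y , update k (fun σ) _ (proj₁ y F.≟ k) (proj₂ y))
      extend-mono (inter r) = inter r
      extend-mono {j , _} (intra p) = intra (update-mono σ (j F.≟ k) p)

  raiseAt : ∀ {k} → RightClosed (Ls k) → (b : Carrier (Ls k)) →
            Σ (L ↣ L) λ s → ∀ z → toℕ k ≤ pos z → Weak L (k , b) (fun s z)
  raiseAt {k} rc b = extendAt k σ , above
    where
      σ = proj₁ (raise rc b)
      above : ∀ z → toℕ k ≤ pos z → Weak L (k , b) (fun (extendAt k σ) z)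
      above (j , a) k≤j with m≤n⇒m<n∨m≡n k≤j
      ... | inj₁ k<j = inj₂ (inter k<j)
      ... | inj₂ k≡j with FP.toℕ-injective k≡j
      ... | refl = subst (λ v → Weak L (k , b) (k , v)) (sym (update-self (fun σ) (k F.≟ k) a))
                         (weak-ι (proj₂ (raise rc b) a))

  lowerAt : ∀ {k} → LeftClosed (Ls k) → (b : Carrier (Ls k)) →
            Σ (L ↣ L) λ s → ∀ z → pos z ≤ toℕ k → Weak L (fun s z) (k , b)
  lowerAt {k} lc b = extendAt k σ , below
    where
      σ = proj₁ (lower lc b)
      below : ∀ z → pos z ≤ toℕ k → Weak L (fun (extendAt k σ) z) (k , b)
      below (j , a) j≤k with m≤n⇒m<n∨m≡n j≤k
      ... | inj₁ j<k = inj₂ (inter j<k)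
      ... | inj₂ j≡k with FP.toℕ-injective j≡k
      ... | refl = subst (λ v → Weak L (k , v) (k , b)) (sym (update-self (fun σ) (k F.≟ k) a))
                         (weak-ι (proj₂ (lower lc b) a))

  RightClosedAt LeftClosedAt : ℕ → Set₁
  RightClosedAt c = Σ (Fin (suc n)) λ k → (toℕ k ≡ c) × RightClosed (Ls k)
  LeftClosedAt c = Σ (Fin (suc n)) λ k → (toℕ k ≡ c) × LeftClosed (Ls k)

  RigidCut : ℕ → Set₁
  RigidCut c = RightClosedAt c ⊎ LeftClosedAt (suc c)

  singleton-right : ∀ {j} → SingletonAt Ls j → RightClosedAt j
  singleton-right (p , s) = fromℕ< p , FP.toℕ-fromℕ< p , inj₁ s

  singleton-left : ∀ {j} → SingletonAt Ls j → LeftClosedAt j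
  singleton-left (p , s) = fromℕ< p , FP.toℕ-fromℕ< p , inj₁ s

  ω-right : ∀ {j} → ωAt Ls j → RightClosedAt j
  ω-right (p , s) = fromℕ< p , FP.toℕ-fromℕ< p , inj₂ s

  ω*-left : ∀ {j} → ω*At Ls j → LeftClosedAt j
  ω*-left (p , s) = fromℕ< p , FP.toℕ-fromℕ< p , inj₂ s

  StartsAtCut : ℕ → Set₁
  StartsAtCut i = (i ≡ 0) ⊎ Σ ℕ λ c → (i ≡ suc c) × RigidCut c

  leftClosed-start : ∀ {i} → LeftClosedAt i → StartsAtCut i
  leftClosed-start {zero}  _  = inj₁ refl
  leftClosed-start {suc c} lc = inj₂ (c , refl , inj₂ lc)

  blockStart : ∀ {i k} → IsBlock Ls i k → StartsAtCut i
  blockStart {i} {k} (blockA all _ _) = leftClosed-start (singleton-left (all i ≤-refl (m≤m+n i k)))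
  blockStart (blockB _ (inj₁ i≡0) _) = inj₁ i≡0
  blockStart (blockB _ (inj₂ (j , refl , ω , _)) _) = inj₂ (suc j , refl , inj₁ (ω-right ω))
  blockStart {i} {k} (blockC all _ _) = leftClosed-start (ω*-left (all i ≤-refl (m≤m+n i k)))
  blockStart (blockD _ ω* _) = leftClosed-start (ω*-left ω*)

  EndsAtCut : ℕ → Set₁
  EndsAtCut j = (suc j ≡ suc n) ⊎ RigidCut j

  blockEnd : ∀ {i k} → IsBlock Ls i k → EndsAtCut (i + k)
  blockEnd {i} {k} (blockA all _ _) = inj₂ (inj₁ (singleton-right (all (i + k) (m≤m+n i k) ≤-refl)))
  blockEnd {i} {k} (blockB all _ _) = inj₂ (inj₁ (ω-right (all (i + k) (m≤m+n i k) ≤-refl)))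
  blockEnd (blockC _ _ (inj₁ last)) = inj₁ last
  blockEnd (blockC _ _ (inj₂ (ω* , _))) = inj₂ (inj₂ (ω*-left ω*))
  blockEnd {i} (blockD refl _ ω) = inj₂ (inj₁ (subst RightClosedAt (+-comm 1 i) (ω-right ω)))

  module Rigidity (minimal : ¬ SumOfH n L) where

    -- Backward induction on k: if g pushes the tail from Lᵢ but not the one
    -- from L_{i+1}, then g sends Lᵢ into L_{i+1}, below the image of some
    -- point b of L_{i+1}.  A left-closed L_{i+1} is then trapped; an ω-sum
    -- L_{i+1} absorbs Lᵢ, contradicting minimality.
    noTailShift : ∀ k (g : L ↣ L) → ¬ TailShift g k
    noTailShift = >-weakInduction (λ k → ∀ g → ¬ TailShift g k) last step
      where
        last : ∀ g → ¬ TailShift g (fromℕ n)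
        last g push = n≮n n (≤-trans (subst (_< pos (fun g x₀)) (FP.toℕ-fromℕ n) (push x₀ ≤-refl))
                                     (≤-pred (FP.toℕ<n (proj₁ (fun g x₀)))))
          where x₀ = (fromℕ n , point (hs (fromℕ n)))

        step : ∀ i → (∀ g → ¬ TailShift g (F.suc i)) → ∀ g → ¬ TailShift g (inject₁ i)
        step i next g push = tailShiftOrStuck g (F.suc i) λ where
            (inj₁ push′) → next g push′
            (inj₂ (b , stuck)) → case-next b stuck (classifyL (hs (F.suc i)))
          where
            i<i+1 : toℕ (inject₁ i) < toℕ (F.suc i)
            i<i+1 = s≤s (subst (_≤ toℕ i) (sym (FP.toℕ-inject₁ i)) ≤-refl)
            pushed : ∀ a → toℕ (F.suc i) ≤ pos (fun g (inject₁ i , a))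
            pushed a = subst (λ t → suc t ≤ pos (fun g (inject₁ i , a))) (FP.toℕ-inject₁ i)
                             (push (inject₁ i , a) ≤-refl)
            case-next : ∀ b → pos (fun g (F.suc i , b)) ≤ toℕ (F.suc i) →
                        LeftClosed (Ls (F.suc i)) ⊎ IsωSum (Ls (F.suc i)) → ⊥
            case-next b stuck (inj₁ lc) =
              trappedL lc g (inject₁ i , point (hs _)) i<i+1 (pushed _) b stuck
            case-next b stuck (inj₂ ω) =
              absorbRight (hs _) ω (restrictTo (g ∘E ι (inject₁ i)) (F.suc i) into-next)
                          (valueIn _ (fun g (F.suc i , b)) b-at-next)
                          (λ a → valueIn-≺ _ (into-next a) b-at-next (mono g (inter i<i+1)))
                          (minimal ∘ mergeAdjacent Ls i hs)
              where
                before-b : ∀ a → pos (fun g (inject₁ i , a)) ≤ pos (fun g (F.suc i , b))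
                before-b a = pos-mono (mono g (inter i<i+1))
                into-next : ∀ a → pos (fun g (inject₁ i , a)) ≡ toℕ (F.suc i)
                into-next a = squeeze (pushed a) ≤-refl (before-b a) stuck
                b-at-next : pos (fun g (F.suc i , b)) ≡ toℕ (F.suc i)
                b-at-next = squeeze (pushed (point (hs _))) (before-b _) ≤-refl stuck

    noHeadShift : ∀ k (g : L ↣ L) → ¬ HeadShift g k
    noHeadShift = <-weakInduction (λ k → ∀ g → ¬ HeadShift g k) first step
      where
        first : ∀ g → ¬ HeadShift g F.zero
        first g push = n≮0 (push (F.zero , point (hs F.zero)) z≤n)

        step : ∀ i → (∀ g → ¬ HeadShift g (inject₁ i)) → ∀ g → ¬ HeadShift g (F.suc i)
        step i prev g push = headShiftOrStuck g (inject₁ i) λ where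
            (inj₁ push′) → prev g push′
            (inj₂ (b , stuck)) → case-prev b stuck (classifyR (hs (inject₁ i)))
          where
            i<i+1 : toℕ (inject₁ i) < toℕ (F.suc i)
            i<i+1 = s≤s (subst (_≤ toℕ i) (sym (FP.toℕ-inject₁ i)) ≤-refl)
            pushed : ∀ a → pos (fun g (F.suc i , a)) ≤ toℕ (inject₁ i)
            pushed a = subst (pos (fun g (F.suc i , a)) ≤_) (sym (FP.toℕ-inject₁ i))
                             (≤-pred (push (F.suc i , a) ≤-refl))
            case-prev : ∀ b → toℕ (inject₁ i) ≤ pos (fun g (inject₁ i , b)) →
                        RightClosed (Ls (inject₁ i)) ⊎ Isω*Sum (Ls (inject₁ i)) → ⊥
            case-prev b stuck (inj₁ rc) =
              trappedR rc g (F.suc i , point (hs _)) i<i+1 (pushed _) b stuck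
            case-prev b stuck (inj₂ ω*) =
              absorbLeft (hs _) ω* (restrictTo (g ∘E ι (F.suc i)) (inject₁ i) into-prev)
                         (valueIn _ (fun g (inject₁ i , b)) b-at-prev)
                         (λ a → valueIn-≺ _ b-at-prev (into-prev a) (mono g (inter i<i+1)))
                         (minimal ∘ mergeAdjacent Ls i hs)
              where
                after-b : ∀ a → pos (fun g (inject₁ i , b)) ≤ pos (fun g (F.suc i , a))
                after-b a = pos-mono (mono g (inter i<i+1))
                into-prev : ∀ a → pos (fun g (F.suc i , a)) ≡ toℕ (inject₁ i)
                into-prev a = squeeze stuck (after-b a) ≤-refl (pushed a)
                b-at-prev : pos (fun g (inject₁ i , b)) ≡ toℕ (inject₁ i)
                b-at-prev = squeeze stuck ≤-refl (after-b (point (hs _))) (pushed _)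

    rightClosed-keepsHead : ∀ {k} → RightClosed (Ls k) → (f : L ↣ L) →
                            ∀ y → pos y ≤ toℕ k → ¬ (toℕ k < pos (fun f y))
    rightClosed-keepsHead {k} rc f y y≤k k<fy = noTailShift k (f ∘E s) push
      where
        b = proj₁ (lastAt k y≤k)
        s = proj₁ (raiseAt rc b)
        push : TailShift (f ∘E s) k
        push z k≤z = ≤-trans k<fy (≤-trans (pos-weak (weak-map f (proj₂ (lastAt k y≤k))))
                                           (pos-weak (weak-map f (proj₂ (raiseAt rc b) z k≤z))))

    rightClosed-keepsTail : ∀ {k} → RightClosed (Ls k) → (f : L ↣ L) →
                            ∀ x → toℕ k < pos x → ¬ (pos (fun f x) ≤ toℕ k)
    rightClosed-keepsTail {k} rc f x k<x fx≤k = headShiftOrStuck f k λ where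
      (inj₁ push)        → noHeadShift k f push
      (inj₂ (b , stuck)) → trappedR rc f x k<x fx≤k b stuck

    leftClosed-keepsTail : ∀ {k} → LeftClosed (Ls k) → (f : L ↣ L) →
                           ∀ x → toℕ k ≤ pos x → ¬ (pos (fun f x) < toℕ k)
    leftClosed-keepsTail {k} lc f x k≤x fx<k = noHeadShift k (f ∘E s) push
      where
        b = proj₁ (firstAt k k≤x)
        s = proj₁ (lowerAt lc b)
        push : HeadShift (f ∘E s) k
        push z z≤k = ≤-<-trans (≤-trans (pos-weak (weak-map f (proj₂ (lowerAt lc b) z z≤k)))
                                        (pos-weak (weak-map f (proj₂ (firstAt k k≤x))))) fx<k

    leftClosed-keepsHead : ∀ {k} → LeftClosed (Ls k) → (f : L ↣ L) →
                           ∀ y → pos y < toℕ k → ¬ (toℕ k ≤ pos (fun f y))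
    leftClosed-keepsHead {k} lc f y y<k k≤fy = tailShiftOrStuck f k λ where
      (inj₁ push)        → noTailShift k f push
      (inj₂ (b , stuck)) → trappedL lc f y y<k k≤fy b stuck

    cut-head : ∀ {c} → RigidCut c → (f : L ↣ L) → ∀ y → pos y ≤ c → pos (fun f y) ≤ c
    cut-head (inj₁ (k , refl , rc)) f y y≤k =
      decidable-stable (_ ≤? _) λ fy≰k → rightClosed-keepsHead rc f y y≤k (≰⇒> fy≰k)
    cut-head (inj₂ (k , k≡c+1 , lc)) f y y≤c =
      decidable-stable (_ ≤? _) λ fy≰c → leftClosed-keepsHead lc f y
        (subst (pos y <_) (sym k≡c+1) (s≤s y≤c))
        (subst (_≤ pos (fun f y)) (sym k≡c+1) (≰⇒> fy≰c))

    cut-tail : ∀ {c} → RigidCut c → (f : L ↣ L) → ∀ x → suc c ≤ pos x → suc c ≤ pos (fun f x)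
    cut-tail (inj₁ (k , refl , rc)) f x k<x =
      decidable-stable (_ ≤? _) λ fx≯k → rightClosed-keepsTail rc f x k<x (≤-pred (≰⇒> fx≯k))
    cut-tail (inj₂ (k , k≡c+1 , lc)) f x c<x =
      decidable-stable (_ ≤? _) λ fx≯c → leftClosed-keepsTail lc f x
        (subst (_≤ pos x) (sym k≡c+1) c<x)
        (subst (pos (fun f x) <_) (sym k≡c+1) (≰⇒> fx≯c))

lemma6p5 : (m : ℕ) (Ls : Fin m → Ord) → (∀ j → IsH (Ls j)) →
           InCS m (FinSum Ls) →
           (f : FinSum Ls ↪ FinSum Ls) →
           (i k : ℕ) → i + k < m → IsBlock Ls i k →
           ∀ x → InBlock Ls i k x → InBlock Ls i k (proj₁ f x)
lemma6p5 zero Ls hs L∈CS f i k () block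
lemma6p5 (suc n) Ls hs (_ , _ , _ , minimal) f i k _ block x (i≤x , x≤i+k) =
  start (blockStart block) , end (blockEnd block)
  where
    open Decomposition Ls hs
    open Rigidity (minimal n ≤-refl)

    start : StartsAtCut i → i ≤ pos (proj₁ f x)
    start (inj₁ refl)             = z≤n
    start (inj₂ (c , refl , cut)) = cut-tail cut (fromDefs f) x i≤x

    end : EndsAtCut (i + k) → pos (proj₁ f x) ≤ i + k
    end (inj₁ last) = subst (pos (proj₁ f x) ≤_) (sym (suc-injective last)) (≤-pred (FP.toℕ<n _))
    end (inj₂ cut)  = cut-head cut (fromDefs f) x x≤i+k
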